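{- Let $G_1,\dots,G_n$ be simple connected graphs, each with at least one edge, $m_i=|E(G_i)|$, and let $G=G_1\oplus_vG_2\oplus_v\cdots\oplus_vG_n$ be the graph obtained from their disjoint union by identifying one chosen vertex from each $G_i$ into a single vertex $v$. Then $$\mathscr{K}(G)=\frac{\sum_{i=1}^n m_i\left(\mathscr{K}(G_i)+\sum_{j\neq i}\mu(G_j,v)\right)}{\sum_{i=1}^n m_i}.$$
   Context: All graphs are finite, simple, undirected. For a connected graph $H$ with Laplacian $L$, the effective resistance is $r_H(i,j)=(e_i-e_j)^TL^\dagger(e_i-e_j)$ ($L^\dagger$ the Moore–Penrose pseudoinverse), i.e. the resistance between $i$ and $j$ with unit resistors on edges. For a connected graph $H$ with $m\ge1$ edges and degrees $d_i$, Kemeny's constant is $\mathscr{K}(H)=\sum_j\pi_jm_{ij}$ for the simple random walk on $H$ ($\pi_j=d_j/2m$, $m_{ij}$ expected hitting time of $j$ from $i$, $m_{jj}=0$), which equals $\frac{1}{4m}\sum_{i,j}d_id_jr_H(i,j)$. The moment of a vertex $v$ of $H$ is $\mu(H,v)=\sum_{i\in V(H)}d_i\,r_H(i,v)$; here $\mu(G_j,v)$ refers to the identified vertex viewed as a vertex of $G_j$. -}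

module Defs where

open import Data.Nat as ℕ using (ℕ; zero; suc)
open import Data.Integer using (+_)
open import Data.Rational using (ℚ; 0ℚ; 1ℚ; _+_; _*_; _-_; _/_)
open import Data.Fin using (Fin; zero; suc; _<?_)
open import Data.Fin.Properties using (_≟_)
open import Data.Bool using (Bool; true; false; if_then_else_)
open import Data.Product using (Σ; _×_; ∃; ∃-syntax; _,_)
open import Relation.Nullary using (¬_; yes; no)
open import Relation.Nullary.Decidable using (⌊_⌋)
open import Relation.Binary.PropositionalEquality using (_≡_)

ℕtoℚ : ℕ → ℚ
ℕtoℚ k = + k / 1

-- 1/k for k ≥ 1 (and 0 for k = 0; only used when k ≥ 1)
invℕ : ℕ → ℚ
invℕ zero    = 0ℚ
invℕ (suc k) = + 1 / suc k

sumℚ : (N : ℕ) → (Fin N → ℚ) → ℚ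
sumℚ zero    f = 0ℚ
sumℚ (suc N) f = f zero + sumℚ N (λ i → f (suc i))

sumℕ : (N : ℕ) → (Fin N → ℕ) → ℕ
sumℕ zero    f = 0
sumℕ (suc N) f = f zero ℕ.+ sumℕ N (λ i → f (suc i))

record Graph (N : ℕ) : Set where
  field
    adj    : Fin N → Fin N → Bool
    sym    : ∀ i j → adj i j ≡ adj j i
    irrefl : ∀ i → adj i i ≡ false
open Graph public

bool→ℕ : Bool → ℕ
bool→ℕ true  = 1
bool→ℕ false = 0

degree : ∀ {N} → Graph N → Fin N → ℕ
degree {N} G i = sumℕ N (λ j → bool→ℕ (adj G i j))

numEdges : ∀ {N} → Graph N → ℕ
numEdges {N} G = sumℕ N (λ i → sumℕ N (λ j →
  if ⌊ i <? j ⌋ then bool→ℕ (adj G i j) else 0))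

data Walk {N : ℕ} (G : Graph N) : Fin N → Fin N → Set where
  here : ∀ {i} → Walk G i i
  step : ∀ {i j k} → adj G i j ≡ true → Walk G j k → Walk G i k

Connected : ∀ {N} → Graph N → Set
Connected G = ∀ i j → Walk G i j

laplacian : ∀ {N} → Graph N → (Fin N → ℚ) → Fin N → ℚ
laplacian {N} G x k =
  ℕtoℚ (degree G k) * x k - sumℚ N (λ l → if adj G k l then x l else 0ℚ)

basis : ∀ {N} → Fin N → Fin N → ℚ
basis i k = if ⌊ i ≟ k ⌋ then 1ℚ else 0ℚ

-- r is the effective-resistance function of G:
-- r(i,j) = (e_i - e_j)ᵀ x for a solution x of L x = e_i - e_j
-- (x = L†(e_i-e_j) is one such solution; for connected G any two
--  solutions differ by a constant vector, so r(i,j) is determined).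
IsEffRes : ∀ {N} → Graph N → (Fin N → Fin N → ℚ) → Set
IsEffRes {N} G r = ∀ i j → Σ (Fin N → ℚ) λ x →
  (∀ k → laplacian G x k ≡ basis i k - basis j k) × (r i j ≡ x i - x j)

kemeny : ∀ {N} → Graph N → (Fin N → Fin N → ℚ) → ℚ
kemeny {N} G r =
  invℕ (4 ℕ.* numEdges G) *
    sumℚ N (λ i → sumℚ N (λ j →
      ℕtoℚ (degree G i) * ℕtoℚ (degree G j) * r i j))

moment : ∀ {N} → Graph N → (Fin N → Fin N → ℚ) → Fin N → ℚ
moment {N} G r v = sumℚ N (λ i → ℕtoℚ (degree G i) * r i v)

-- G (on Fin N, with distinguished vertex c) is the graph obtained from the
-- disjoint union of Gs i (i : Fin n) by identifying the vertices vs i into c;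
-- φ i is the (injective) inclusion of Gs i into G.
record IsVertexSum {n N : ℕ} (k : Fin n → ℕ) (Gs : (i : Fin n) → Graph (k i))
    (vs : (i : Fin n) → Fin (k i)) (G : Graph N) (c : Fin N)
    (φ : (i : Fin n) → Fin (k i) → Fin N) : Set where
  field
    glue     : ∀ i → φ i (vs i) ≡ c
    inj      : ∀ i a b → φ i a ≡ φ i b → a ≡ b
    disjoint : ∀ i j a b → ¬ (i ≡ j) → φ i a ≡ φ j b → a ≡ vs i
    cover    : ∀ x → ∃[ i ] ∃[ a ] (φ i a ≡ x)
    adjIn    : ∀ i a b → adj G (φ i a) (φ i b) ≡ adj (Gs i) a b
    adjOnly  : ∀ x y → adj G x y ≡ true →
               ∃[ i ] ∃[ a ] ∃[ b ] (φ i a ≡ x × φ i b ≡ y)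

{-# OPTIONS --safe #-}
module Submission where

-- Write W(H, r) = Σᵢⱼ dᵢ dⱼ r(i, j), so that W(H, r) = 4 m K(H). Every vertex of G other than v lies
-- in exactly one Gₗ and keeps its degree there, while d_G(v) = Σₗ d_{Gₗ}(v); hence degree-weighted sums
-- over G split into sums over the components, and in particular m = Σₗ mₗ. Since v is a cut vertex,
-- resistances are local: r_G = r_{Gₗ} inside Gₗ, and r_G(a, b) = r_{Gₗ}(a, v) + r_{Gₗ′}(v, b) for a in
-- Gₗ and b in Gₗ′ with l ≠ l′. Splitting W(G, r) into blocks over pairs of components therefore gives
--   W(G, r) = Σₗ W(Gₗ, rₗ) + Σ_{l ≠ l′} (2 mₗ′ μₗ + 2 mₗ μₗ′) = 4 Σₗ mₗ (K(Gₗ) + Σ_{j ≠ l} μⱼ).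
-- Both locality statements only need some potential x with L x = eᵢ − eⱼ, which IsEffRes provides:
-- by reciprocity, (eₚ − e_q)ᵀ x = (eᵢ − eⱼ)ᵀ y whenever L y = eₚ − e_q, so any such potential computes r,
-- and a potential on G restricts to one on Gₗ.

open import Defs hiding (sym)
open import Algebra.Properties.Group using (x∙y⁻¹≈ε⇒x≈y; x≈y⇒x∙y⁻¹≈ε)
open import Data.Bool using (true; false; if_then_else_)
open import Data.Fin using (Fin; zero; suc; _<_; _<?_)
open import Data.Fin.Properties using (_≟_; suc-injective; <-cmp)
import Data.Integer as ℤ
import Data.Integer.Properties as ℤ
open import Data.Nat as ℕ using (ℕ; zero; suc; _≤_)
import Data.Nat.Properties as ℕ
open import Data.Product using (_,_; proj₂)
open import Data.Rational using (ℚ; 0ℚ; 1ℚ; _+_; _*_; _-_; -_; toℚᵘ)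
import Data.Rational.Properties as ℚ
open import Data.Rational.Solver using (module +-*-Solver)
open import Data.Rational.Unnormalised as ℚᵘ using (ℚᵘ; mkℚᵘ; *≡*) renaming (_≃_ to _≃ᵘ_)
import Data.Rational.Unnormalised.Properties as ℚᵘ
open import Function using (_∘_)
open import Relation.Binary.Definitions using (tri<; tri≈; tri>)
open import Relation.Binary.PropositionalEquality
open import Relation.Nullary using (¬_; yes; no; contradiction)
open import Relation.Nullary.Decidable using (⌊_⌋; dec-yes; dec-no)

open +-*-Solver using (solve; _:+_; _:*_; _:-_; :-_; _:=_; con)
open ≡-Reasoning

private
  ℕtoℚᵘ : ℕ → ℚᵘ
  ℕtoℚᵘ k = mkℚᵘ (ℤ.+ k) 0

  toℚᵘ-ℕtoℚ : ∀ k → toℚᵘ (ℕtoℚ k) ≃ᵘ ℕtoℚᵘ k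
  toℚᵘ-ℕtoℚ k = ℚ.toℚᵘ-fromℚᵘ (ℕtoℚᵘ k)

  ℕtoℚᵘ-+ : ∀ a b → ℕtoℚᵘ (a ℕ.+ b) ≃ᵘ ℕtoℚᵘ a ℚᵘ.+ ℕtoℚᵘ b
  ℕtoℚᵘ-+ a b = *≡* (cong (ℤ._* ℤ.+ 1) (trans (ℤ.pos-+ a b)
    (sym (cong₂ ℤ._+_ (ℤ.*-identityʳ (ℤ.+ a)) (ℤ.*-identityʳ (ℤ.+ b))))))

  ℕtoℚᵘ-* : ∀ a b → ℕtoℚᵘ (a ℕ.* b) ≃ᵘ ℕtoℚᵘ a ℚᵘ.* ℕtoℚᵘ b
  ℕtoℚᵘ-* a b = *≡* (cong (ℤ._* ℤ.+ 1) (ℤ.pos-* a b))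

ℕtoℚ-+ : ∀ a b → ℕtoℚ (a ℕ.+ b) ≡ ℕtoℚ a + ℕtoℚ b
ℕtoℚ-+ a b = ℚ.toℚᵘ-injective
  (ℚᵘ.≃-trans (toℚᵘ-ℕtoℚ (a ℕ.+ b)) (ℚᵘ.≃-trans (ℕtoℚᵘ-+ a b) (ℚᵘ.≃-sym
    (ℚᵘ.≃-trans (ℚ.toℚᵘ-homo-+ (ℕtoℚ a) (ℕtoℚ b)) (ℚᵘ.+-cong (toℚᵘ-ℕtoℚ a) (toℚᵘ-ℕtoℚ b))))))

ℕtoℚ-* : ∀ a b → ℕtoℚ (a ℕ.* b) ≡ ℕtoℚ a * ℕtoℚ b
ℕtoℚ-* a b = ℚ.toℚᵘ-injective
  (ℚᵘ.≃-trans (toℚᵘ-ℕtoℚ (a ℕ.* b)) (ℚᵘ.≃-trans (ℕtoℚᵘ-* a b) (ℚᵘ.≃-sym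
    (ℚᵘ.≃-trans (ℚ.toℚᵘ-homo-* (ℕtoℚ a) (ℕtoℚ b)) (ℚᵘ.*-cong (toℚᵘ-ℕtoℚ a) (toℚᵘ-ℕtoℚ b))))))

ℕtoℚ-injective : ∀ {a b} → ℕtoℚ a ≡ ℕtoℚ b → a ≡ b
ℕtoℚ-injective {a} {b} eq
  with *≡* e ← ℚᵘ.≃-trans (ℚᵘ.≃-sym (toℚᵘ-ℕtoℚ a)) (ℚᵘ.≃-trans (ℚ.toℚᵘ-cong eq) (toℚᵘ-ℕtoℚ b))
  = ℤ.+-injective (trans (sym (ℤ.*-identityʳ (ℤ.+ a))) (trans e (ℤ.*-identityʳ (ℤ.+ b))))

invℕ-inverseˡ : ∀ k → invℕ (suc k) * ℕtoℚ (suc k) ≡ 1ℚ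
invℕ-inverseˡ k = ℚ.toℚᵘ-injective
  (ℚᵘ.≃-trans (ℚ.toℚᵘ-homo-* (invℕ (suc k)) (ℕtoℚ (suc k)))
    (ℚᵘ.≃-trans (ℚᵘ.*-cong (ℚ.toℚᵘ-fromℚᵘ (mkℚᵘ (ℤ.+ 1) k)) (toℚᵘ-ℕtoℚ (suc k)))
      (ℚᵘ.*-inverseˡ (ℕtoℚᵘ (suc k)))))

invℕ-* : ∀ a b → invℕ (a ℕ.* b) ≡ invℕ a * invℕ b
invℕ-* zero    b       = sym (ℚ.*-zeroˡ (invℕ b))
invℕ-* (suc a) zero    = trans (cong invℕ (ℕ.*-zeroʳ a)) (sym (ℚ.*-zeroʳ (invℕ (suc a))))
invℕ-* (suc a) (suc b) = ℚ.toℚᵘ-injective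
  (ℚᵘ.≃-trans (ℚ.toℚᵘ-fromℚᵘ (mkℚᵘ (ℤ.+ 1) (b ℕ.+ a ℕ.* suc b))) (ℚᵘ.≃-sym
    (ℚᵘ.≃-trans (ℚ.toℚᵘ-homo-* (invℕ (suc a)) (invℕ (suc b)))
      (ℚᵘ.*-cong (ℚ.toℚᵘ-fromℚᵘ (mkℚᵘ (ℤ.+ 1) a)) (ℚ.toℚᵘ-fromℚᵘ (mkℚᵘ (ℤ.+ 1) b))))))

ℕtoℚ-*-invℕ : ∀ q → 1 ≤ q → ∀ x → ℕtoℚ q * (invℕ q * x) ≡ x
ℕtoℚ-*-invℕ (suc q) _ x = begin
  ℕtoℚ (suc q) * (invℕ (suc q) * x)   ≡⟨ ℚ.*-assoc (ℕtoℚ (suc q)) _ x ⟨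
  ℕtoℚ (suc q) * invℕ (suc q) * x     ≡⟨ cong (_* x) (trans (ℚ.*-comm (ℕtoℚ (suc q)) _) (invℕ-inverseˡ q)) ⟩
  1ℚ * x                              ≡⟨ ℚ.*-identityˡ x ⟩
  x                                   ∎

invℕ-*-ℕtoℚ : ∀ q M x → invℕ (suc q ℕ.* M) * (ℕtoℚ (suc q) * x) ≡ x * invℕ M
invℕ-*-ℕtoℚ q M x = begin
  invℕ (suc q ℕ.* M) * (ℕtoℚ (suc q) * x)
    ≡⟨ cong (_* (ℕtoℚ (suc q) * x)) (invℕ-* (suc q) M) ⟩
  invℕ (suc q) * invℕ M * (ℕtoℚ (suc q) * x)
    ≡⟨ solve 4 (λ a b c y → a :* b :* (c :* y) := a :* c :* (y :* b)) refl
         (invℕ (suc q)) (invℕ M) (ℕtoℚ (suc q)) x ⟩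
  invℕ (suc q) * ℕtoℚ (suc q) * (x * invℕ M)
    ≡⟨ cong (_* (x * invℕ M)) (invℕ-inverseˡ q) ⟩
  1ℚ * (x * invℕ M)
    ≡⟨ ℚ.*-identityˡ (x * invℕ M) ⟩
  x * invℕ M ∎

sumℚ-cong : ∀ N {f g : Fin N → ℚ} → (∀ i → f i ≡ g i) → sumℚ N f ≡ sumℚ N g
sumℚ-cong zero    f≗g = refl
sumℚ-cong (suc N) f≗g = cong₂ _+_ (f≗g zero) (sumℚ-cong N (f≗g ∘ suc))

sumℚ-zero : ∀ N {f : Fin N → ℚ} → (∀ i → f i ≡ 0ℚ) → sumℚ N f ≡ 0ℚ
sumℚ-zero zero    f≗0 = refl
sumℚ-zero (suc N) f≗0 = cong₂ _+_ (f≗0 zero) (sumℚ-zero N (f≗0 ∘ suc))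

sumℚ-+ : ∀ N (f g : Fin N → ℚ) → sumℚ N (λ i → f i + g i) ≡ sumℚ N f + sumℚ N g
sumℚ-+ zero    f g = refl
sumℚ-+ (suc N) f g = trans (cong ((f zero + g zero) +_) (sumℚ-+ N (f ∘ suc) (g ∘ suc)))
  (solve 4 (λ a b c d → (a :+ b) :+ (c :+ d) := (a :+ c) :+ (b :+ d)) refl (f zero) (g zero) _ _)

sumℚ-difference : ∀ N (f g : Fin N → ℚ) → sumℚ N (λ i → f i - g i) ≡ sumℚ N f - sumℚ N g
sumℚ-difference zero    f g = refl
sumℚ-difference (suc N) f g = trans (cong ((f zero - g zero) +_) (sumℚ-difference N (f ∘ suc) (g ∘ suc)))
  (solve 4 (λ a b c d → (a :- b) :+ (c :- d) := (a :+ c) :- (b :+ d)) refl (f zero) (g zero) _ _)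

sumℚ-*ˡ : ∀ N c (f : Fin N → ℚ) → c * sumℚ N f ≡ sumℚ N (λ i → c * f i)
sumℚ-*ˡ zero    c f = ℚ.*-zeroʳ c
sumℚ-*ˡ (suc N) c f = trans (ℚ.*-distribˡ-+ c (f zero) _) (cong (c * f zero +_) (sumℚ-*ˡ N c (f ∘ suc)))

sumℚ-*ʳ : ∀ N c (f : Fin N → ℚ) → sumℚ N f * c ≡ sumℚ N (λ i → f i * c)
sumℚ-*ʳ N c f = trans (ℚ.*-comm _ c) (trans (sumℚ-*ˡ N c f) (sumℚ-cong N (λ i → ℚ.*-comm c (f i))))

sumℚ-comm : ∀ M N (f : Fin M → Fin N → ℚ) →
            sumℚ M (λ i → sumℚ N (f i)) ≡ sumℚ N (λ j → sumℚ M (λ i → f i j))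
sumℚ-comm zero    N f = sym (sumℚ-zero N (λ _ → refl))
sumℚ-comm (suc M) N f = trans (cong (sumℚ N (f zero) +_) (sumℚ-comm M N (f ∘ suc)))
  (sym (sumℚ-+ N (f zero) (λ j → sumℚ M (λ i → f (suc i) j))))

sumℚ-single : ∀ N {f : Fin N → ℚ} i → (∀ j → j ≢ i → f j ≡ 0ℚ) → sumℚ N f ≡ f i
sumℚ-single (suc N) {f} zero    f≗0 =
  trans (cong (f zero +_) (sumℚ-zero N (λ j → f≗0 (suc j) λ ()))) (ℚ.+-identityʳ (f zero))
sumℚ-single (suc N) {f} (suc i) f≗0 =
  trans (cong₂ _+_ (f≗0 zero λ ()) (sumℚ-single N i (λ j j≢i → f≗0 (suc j) (j≢i ∘ suc-injective))))
        (ℚ.+-identityˡ (f (suc i)))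

sumℚ-agree : ∀ N {f g : Fin N → ℚ} i → (∀ j → j ≢ i → f j ≡ g j) → sumℚ N f ≡ sumℚ N g → f i ≡ g i
sumℚ-agree N {f} {g} i f≗g Σf≡Σg = x∙y⁻¹≈ε⇒x≈y ℚ.+-0-group (f i) (g i) (begin
  f i - g i                  ≡⟨ sumℚ-single N i (λ j j≢i → x≈y⇒x∙y⁻¹≈ε ℚ.+-0-group (f≗g j j≢i)) ⟨
  sumℚ N (λ j → f j - g j)   ≡⟨ sumℚ-difference N f g ⟩
  sumℚ N f - sumℚ N g        ≡⟨ x≈y⇒x∙y⁻¹≈ε ℚ.+-0-group Σf≡Σg ⟩
  0ℚ                         ∎)

sumℚ-separable : ∀ M K (u f : Fin M → ℚ) (w g : Fin K → ℚ) →
                 sumℚ M (λ a → sumℚ K (λ b → u a * w b * (f a + g b)))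
                 ≡ sumℚ M (λ a → u a * f a) * sumℚ K w + sumℚ M u * sumℚ K (λ b → w b * g b)
sumℚ-separable M K u f w g = begin
  sumℚ M (λ a → sumℚ K (λ b → u a * w b * (f a + g b)))
    ≡⟨ sumℚ-cong M (λ a → sumℚ-cong K (λ b →
         solve 4 (λ u w f g → u :* w :* (f :+ g) := u :* f :* w :+ u :* (w :* g)) refl (u a) (w b) (f a) (g b))) ⟩
  sumℚ M (λ a → sumℚ K (λ b → u a * f a * w b + u a * (w b * g b)))
    ≡⟨ sumℚ-cong M (λ a → trans (sumℚ-+ K _ _)
         (sym (cong₂ _+_ (sumℚ-*ˡ K (u a * f a) w) (sumℚ-*ˡ K (u a) _)))) ⟩
  sumℚ M (λ a → u a * f a * sumℚ K w + u a * sumℚ K (λ b → w b * g b))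
    ≡⟨ sumℚ-+ M _ _ ⟩
  sumℚ M (λ a → u a * f a * sumℚ K w) + sumℚ M (λ a → u a * sumℚ K (λ b → w b * g b))
    ≡⟨ sym (cong₂ _+_ (sumℚ-*ʳ M (sumℚ K w) (λ a → u a * f a)) (sumℚ-*ʳ M (sumℚ K (λ b → w b * g b)) u)) ⟩
  sumℚ M (λ a → u a * f a) * sumℚ K w + sumℚ M u * sumℚ K (λ b → w b * g b) ∎

sumℕ-ℕtoℚ : ∀ N (f : Fin N → ℕ) → ℕtoℚ (sumℕ N f) ≡ sumℚ N (ℕtoℚ ∘ f)
sumℕ-ℕtoℚ zero    f = refl
sumℕ-ℕtoℚ (suc N) f = trans (ℕtoℚ-+ (f zero) _) (cong (ℕtoℚ (f zero) +_) (sumℕ-ℕtoℚ N (f ∘ suc)))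

module _ {N : ℕ} where

  basis-refl : ∀ (i : Fin N) → basis i i ≡ 1ℚ
  basis-refl i = cong (λ d → if ⌊ d ⌋ then 1ℚ else 0ℚ) (proj₂ (dec-yes (i ≟ i) refl))

  basis-≢ : ∀ {i j : Fin N} → i ≢ j → basis i j ≡ 0ℚ
  basis-≢ {i} {j} i≢j = cong (λ d → if ⌊ d ⌋ then 1ℚ else 0ℚ) (dec-no (i ≟ j) i≢j)

  basis-*-≡ : ∀ (i j : Fin N) t → i ≡ j → basis i j * t ≡ t
  basis-*-≡ i _ t refl = trans (cong (_* t) (basis-refl i)) (ℚ.*-identityˡ t)

  basis-*-≢ : ∀ {i j : Fin N} t → i ≢ j → basis i j * t ≡ 0ℚ
  basis-*-≢ t i≢j = trans (cong (_* t) (basis-≢ i≢j)) (ℚ.*-zeroˡ t)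

  basis-*-zero : ∀ (i j : Fin N) {t} → (i ≡ j → t ≡ 0ℚ) → basis i j * t ≡ 0ℚ
  basis-*-zero i j {t} t≡0 with i ≟ j
  ... | yes i≡j = trans (ℚ.*-identityˡ t) (t≡0 i≡j)
  ... | no  _   = ℚ.*-zeroˡ t

  sumℚ-basis : ∀ (i : Fin N) (f : Fin N → ℚ) → sumℚ N (λ j → basis i j * f j) ≡ f i
  sumℚ-basis i f = trans (sumℚ-single N i (λ j j≢i → basis-*-≢ (f j) (j≢i ∘ sym))) (basis-*-≡ i i (f i) refl)

  sumℚ-basis-difference : ∀ (i j : Fin N) (x : Fin N → ℚ) → sumℚ N (λ k → (basis i k - basis j k) * x k) ≡ x i - x j
  sumℚ-basis-difference i j x = begin
    sumℚ N (λ k → (basis i k - basis j k) * x k)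
      ≡⟨ sumℚ-cong N (λ k → solve 3 (λ a b c → (a :- b) :* c := a :* c :- b :* c) refl
           (basis i k) (basis j k) (x k)) ⟩
    sumℚ N (λ k → basis i k * x k - basis j k * x k)
      ≡⟨ sumℚ-difference N (λ k → basis i k * x k) (λ k → basis j k * x k) ⟩
    sumℚ N (λ k → basis i k * x k) - sumℚ N (λ k → basis j k * x k)
      ≡⟨ cong₂ _-_ (sumℚ-basis i x) (sumℚ-basis j x) ⟩
    x i - x j ∎

sumExcept : ∀ n → Fin n → (Fin n → ℚ) → ℚ
sumExcept n i f = sumℚ n (λ j → if ⌊ j ≟ i ⌋ then 0ℚ else f j)

module _ {n : ℕ} where

  sumExcept-split : ∀ (i : Fin n) f → sumℚ n f ≡ f i + sumExcept n i f
  sumExcept-split i f = begin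
    sumℚ n f
      ≡⟨ sumℚ-cong n split ⟩
    sumℚ n (λ j → basis i j * f j + (if ⌊ j ≟ i ⌋ then 0ℚ else f j))
      ≡⟨ sumℚ-+ n _ _ ⟩
    sumℚ n (λ j → basis i j * f j) + sumExcept n i f
      ≡⟨ cong (_+ sumExcept n i f) (sumℚ-basis i f) ⟩
    f i + sumExcept n i f ∎
    where
    split : ∀ j → f j ≡ basis i j * f j + (if ⌊ j ≟ i ⌋ then 0ℚ else f j)
    split j with j ≟ i
    ... | yes refl = sym (trans (ℚ.+-identityʳ _) (basis-*-≡ j j (f j) refl))
    ... | no  j≢i  = sym (trans (cong (_+ f j) (basis-*-≢ (f j) (j≢i ∘ sym))) (ℚ.+-identityˡ (f j)))

  sumExcept-cong : ∀ (i : Fin n) {f g} → (∀ j → j ≢ i → f j ≡ g j) → sumExcept n i f ≡ sumExcept n i g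
  sumExcept-cong i {f} {g} f≗g = sumℚ-cong n pointwise
    where
    pointwise : ∀ j → (if ⌊ j ≟ i ⌋ then 0ℚ else f j) ≡ (if ⌊ j ≟ i ⌋ then 0ℚ else g j)
    pointwise j with j ≟ i
    ... | yes _   = refl
    ... | no  j≢i = f≗g j j≢i

  sumExcept-+ : ∀ (i : Fin n) f g → sumExcept n i (λ j → f j + g j) ≡ sumExcept n i f + sumExcept n i g
  sumExcept-+ i f g = trans (sumℚ-cong n (λ j → if-0-+ ⌊ j ≟ i ⌋ (f j) (g j))) (sumℚ-+ n _ _)
    where
    if-0-+ : ∀ b s t → (if b then 0ℚ else s + t) ≡ (if b then 0ℚ else s) + (if b then 0ℚ else t)
    if-0-+ true  s t = refl
    if-0-+ false s t = refl

  sumExcept-*ˡ : ∀ (i : Fin n) c f → c * sumExcept n i f ≡ sumExcept n i (λ j → c * f j)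
  sumExcept-*ˡ i c f = trans (sumℚ-*ˡ n c _) (sumℚ-cong n (λ j → if-0-* ⌊ j ≟ i ⌋ (f j)))
    where
    if-0-* : ∀ b t → c * (if b then 0ℚ else t) ≡ (if b then 0ℚ else c * t)
    if-0-* true  t = ℚ.*-zeroʳ c
    if-0-* false t = refl

  sumℚ-sumExcept-comm : ∀ (F : Fin n → Fin n → ℚ) →
                        sumℚ n (λ i → sumExcept n i (F i)) ≡ sumℚ n (λ j → sumExcept n j (λ i → F i j))
  sumℚ-sumExcept-comm F = trans (sumℚ-comm n n _) (sumℚ-cong n (λ j → sumℚ-cong n (λ i → excluded-sym j i)))
    where
    excluded-sym : ∀ j i → (if ⌊ j ≟ i ⌋ then 0ℚ else F i j) ≡ (if ⌊ i ≟ j ⌋ then 0ℚ else F i j)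
    excluded-sym j i with j ≟ i | i ≟ j
    ... | yes _   | yes _   = refl
    ... | no  _   | no  _   = refl
    ... | yes j≡i | no  i≢j = contradiction (sym j≡i) i≢j
    ... | no  j≢i | yes i≡j = contradiction (sym i≡j) j≢i

  sumℚ-sumExcept-symmetric : ∀ (f g : Fin n → ℚ) →
    sumℚ n (λ i → sumExcept n i (λ j → f i * g j + g i * f j)) ≡ ℕtoℚ 2 * sumℚ n (λ i → g i * sumExcept n i f)
  sumℚ-sumExcept-symmetric f g = begin
    sumℚ n (λ i → sumExcept n i (λ j → f i * g j + g i * f j))
      ≡⟨ trans (sumℚ-cong n (λ i → sumExcept-+ i _ _)) (sumℚ-+ n _ _) ⟩
    sumℚ n (λ i → sumExcept n i (λ j → f i * g j)) + Z′
      ≡⟨ cong (_+ Z′) (trans (sumℚ-sumExcept-comm (λ i j → f i * g j))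
           (sumℚ-cong n (λ j → sumExcept-cong j (λ i _ → ℚ.*-comm (f i) (g j))))) ⟩
    Z′ + Z′
      ≡⟨ cong₂ _+_ Z′≡Z Z′≡Z ⟩
    Z + Z
      ≡⟨ solve 1 (λ z → z :+ z := con (ℕtoℚ 2) :* z) refl Z ⟩
    ℕtoℚ 2 * Z ∎
    where
    Z Z′ : ℚ
    Z  = sumℚ n (λ i → g i * sumExcept n i f)
    Z′ = sumℚ n (λ i → sumExcept n i (λ j → g i * f j))

    Z′≡Z : Z′ ≡ Z
    Z′≡Z = sumℚ-cong n (λ i → sym (sumExcept-*ˡ i (g i) f))

module _ {N : ℕ} (H : Graph N) where

  adjℚ : Fin N → Fin N → ℚ
  adjℚ i j = ℕtoℚ (bool→ℕ (adj H i j))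

  degreeℚ : Fin N → ℚ
  degreeℚ i = ℕtoℚ (degree H i)

  degreeℚ-sum : ∀ i → degreeℚ i ≡ sumℚ N (adjℚ i)
  degreeℚ-sum i = sumℕ-ℕtoℚ N (λ j → bool→ℕ (adj H i j))

  laplacian-adjℚ : ∀ (x : Fin N → ℚ) i → laplacian H x i ≡ degreeℚ i * x i - sumℚ N (λ j → adjℚ i j * x j)
  laplacian-adjℚ x i = cong (λ s → degreeℚ i * x i - s) (sumℚ-cong N (λ j → if-then-0 (adj H i j) (x j)))
    where
    if-then-0 : ∀ b t → (if b then t else 0ℚ) ≡ ℕtoℚ (bool→ℕ b) * t
    if-then-0 true  t = sym (ℚ.*-identityˡ t)
    if-then-0 false t = sym (ℚ.*-zeroˡ t)

  laplacian-symmetric : ∀ (x y : Fin N → ℚ) →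
                        sumℚ N (λ i → laplacian H x i * y i) ≡ sumℚ N (λ i → laplacian H y i * x i)
  laplacian-symmetric x y = begin
    sumℚ N (λ i → laplacian H x i * y i)   ≡⟨ form x y ⟩
    diagonal x y - offDiagonal x y         ≡⟨ cong₂ _-_ diagonal-sym offDiagonal-sym ⟩
    diagonal y x - offDiagonal y x         ≡⟨ form y x ⟨
    sumℚ N (λ i → laplacian H y i * x i)   ∎
    where
    diagonal offDiagonal : (Fin N → ℚ) → (Fin N → ℚ) → ℚ
    diagonal    x y = sumℚ N (λ i → degreeℚ i * x i * y i)
    offDiagonal x y = sumℚ N (λ i → sumℚ N (λ j → adjℚ i j * x j * y i))

    form : ∀ x y → sumℚ N (λ i → laplacian H x i * y i) ≡ diagonal x y - offDiagonal x y
    form x y = begin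
      sumℚ N (λ i → laplacian H x i * y i)
        ≡⟨ sumℚ-cong N (λ i → cong (_* y i) (laplacian-adjℚ x i)) ⟩
      sumℚ N (λ i → (degreeℚ i * x i - sumℚ N (λ j → adjℚ i j * x j)) * y i)
        ≡⟨ sumℚ-cong N (λ i → solve 4 (λ d a s b → (d :* a :- s) :* b := d :* a :* b :- s :* b) refl
             (degreeℚ i) (x i) (sumℚ N (λ j → adjℚ i j * x j)) (y i)) ⟩
      sumℚ N (λ i → degreeℚ i * x i * y i - sumℚ N (λ j → adjℚ i j * x j) * y i)
        ≡⟨ sumℚ-cong N (λ i → cong (λ s → degreeℚ i * x i * y i - s) (sumℚ-*ʳ N (y i) (λ j → adjℚ i j * x j))) ⟩
      sumℚ N (λ i → degreeℚ i * x i * y i - sumℚ N (λ j → adjℚ i j * x j * y i))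
        ≡⟨ sumℚ-difference N _ _ ⟩
      diagonal x y - offDiagonal x y ∎

    diagonal-sym : diagonal x y ≡ diagonal y x
    diagonal-sym = sumℚ-cong N (λ i → solve 3 (λ d a b → d :* a :* b := d :* b :* a) refl (degreeℚ i) (x i) (y i))

    offDiagonal-sym : offDiagonal x y ≡ offDiagonal y x
    offDiagonal-sym = trans (sumℚ-comm N N (λ i j → adjℚ i j * x j * y i)) (sumℚ-cong N (λ j → sumℚ-cong N (λ i →
      trans (cong (λ b → ℕtoℚ (bool→ℕ b) * x j * y i) (Graph.sym H i j))
            (solve 3 (λ a b c → a :* b :* c := a :* c :* b) refl (adjℚ j i) (x j) (y i)))))

  sumℚ-laplacian : ∀ (x : Fin N → ℚ) → sumℚ N (laplacian H x) ≡ 0ℚ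
  sumℚ-laplacian x = begin
    sumℚ N (laplacian H x)                         ≡⟨ sumℚ-cong N (λ i → ℚ.*-identityʳ (laplacian H x i)) ⟨
    sumℚ N (λ i → laplacian H x i * 1ℚ)            ≡⟨ laplacian-symmetric x (λ _ → 1ℚ) ⟩
    sumℚ N (λ i → laplacian H (λ _ → 1ℚ) i * x i)  ≡⟨ sumℚ-zero N (λ i →
                                                        trans (cong (_* x i) (laplacian-one i)) (ℚ.*-zeroˡ (x i))) ⟩
    0ℚ                                             ∎
    where
    laplacian-one : ∀ i → laplacian H (λ _ → 1ℚ) i ≡ 0ℚ
    laplacian-one i = begin
      laplacian H (λ _ → 1ℚ) i
        ≡⟨ laplacian-adjℚ (λ _ → 1ℚ) i ⟩
      degreeℚ i * 1ℚ - sumℚ N (λ j → adjℚ i j * 1ℚ)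
        ≡⟨ cong₂ _-_ (trans (ℚ.*-identityʳ (degreeℚ i)) (degreeℚ-sum i))
                     (sumℚ-cong N (λ j → ℚ.*-identityʳ (adjℚ i j))) ⟩
      sumℚ N (adjℚ i) - sumℚ N (adjℚ i)
        ≡⟨ ℚ.+-inverseʳ (sumℚ N (adjℚ i)) ⟩
      0ℚ ∎

  reciprocity : ∀ {i j p q} {x y : Fin N → ℚ} →
                (∀ k → laplacian H x k ≡ basis i k - basis j k) →
                (∀ k → laplacian H y k ≡ basis p k - basis q k) →
                x p - x q ≡ y i - y j
  reciprocity {i} {j} {p} {q} {x} {y} Lx Ly = begin
    x p - x q                                       ≡⟨ sumℚ-basis-difference p q x ⟨
    sumℚ N (λ k → (basis p k - basis q k) * x k)    ≡⟨ sumℚ-cong N (λ k → cong (_* x k) (Ly k)) ⟨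
    sumℚ N (λ k → laplacian H y k * x k)            ≡⟨ laplacian-symmetric y x ⟩
    sumℚ N (λ k → laplacian H x k * y k)            ≡⟨ sumℚ-cong N (λ k → cong (_* y k) (Lx k)) ⟩
    sumℚ N (λ k → (basis i k - basis j k) * y k)    ≡⟨ sumℚ-basis-difference i j y ⟩
    y i - y j                                       ∎

  effRes-unique : ∀ {r} → IsEffRes H r → ∀ {i j} {y : Fin N → ℚ} →
                  (∀ k → laplacian H y k ≡ basis i k - basis j k) → r i j ≡ y i - y j
  effRes-unique R {i} {j} Ly with x , Lx , rᵢⱼ ← R i j = trans rᵢⱼ (reciprocity Lx Ly)

  effRes-sym : ∀ {r} → IsEffRes H r → ∀ i j → r j i ≡ r i j
  effRes-sym {r} R i j with x , Lx , rᵢⱼ ← R i j | y , Ly , rⱼᵢ ← R j i = begin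
    r j i           ≡⟨ rⱼᵢ ⟩
    y j - y i       ≡⟨ solve 2 (λ a b → b :- a := :- (a :- b)) refl (y i) (y j) ⟩
    - (y i - y j)   ≡⟨ cong -_ (reciprocity Lx Ly) ⟨
    - (x j - x i)   ≡⟨ solve 2 (λ a b → :- (b :- a) := a :- b) refl (x i) (x j) ⟩
    x i - x j       ≡⟨ rᵢⱼ ⟨
    r i j           ∎

  handshake : sumℚ N degreeℚ ≡ ℕtoℚ 2 * ℕtoℚ (numEdges H)
  handshake = begin
    sumℚ N degreeℚ
      ≡⟨ sumℚ-cong N degreeℚ-sum ⟩
    sumℚ N (λ i → sumℚ N (adjℚ i))
      ≡⟨ sumℚ-cong N (λ i → trans (sumℚ-cong N (adjℚ-upper i)) (sumℚ-+ N (upper i) (λ j → upper j i))) ⟩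
    sumℚ N (λ i → sumℚ N (upper i) + sumℚ N (λ j → upper j i))
      ≡⟨ sumℚ-+ N _ _ ⟩
    U + sumℚ N (λ i → sumℚ N (λ j → upper j i))
      ≡⟨ cong (U +_) (sumℚ-comm N N upper) ⟨
    U + U
      ≡⟨ solve 1 (λ u → u :+ u := con (ℕtoℚ 2) :* u) refl U ⟩
    ℕtoℚ 2 * U
      ≡⟨ cong (ℕtoℚ 2 *_) (trans (sumℕ-ℕtoℚ N _) (sumℚ-cong N (λ i → sumℕ-ℕtoℚ N _))) ⟨
    ℕtoℚ 2 * ℕtoℚ (numEdges H) ∎
    where
    upper : Fin N → Fin N → ℚ
    upper i j = ℕtoℚ (if ⌊ i <? j ⌋ then bool→ℕ (adj H i j) else 0)

    U : ℚ
    U = sumℚ N (λ i → sumℚ N (upper i))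

    upper-< : ∀ {i j} → i < j → upper i j ≡ adjℚ i j
    upper-< {i} {j} i<j = cong (λ d → ℕtoℚ (if ⌊ d ⌋ then bool→ℕ (adj H i j) else 0))
                               (proj₂ (dec-yes (i <? j) i<j))

    upper-≮ : ∀ {i j} → ¬ i < j → upper i j ≡ 0ℚ
    upper-≮ {i} {j} i≮j = cong (λ d → ℕtoℚ (if ⌊ d ⌋ then bool→ℕ (adj H i j) else 0)) (dec-no (i <? j) i≮j)

    adjℚ-upper : ∀ i j → adjℚ i j ≡ upper i j + upper j i
    adjℚ-upper i j with <-cmp i j
    ... | tri< i<j _ j≮i  = sym (trans (cong₂ _+_ (upper-< i<j) (upper-≮ j≮i)) (ℚ.+-identityʳ (adjℚ i j)))
    ... | tri> i≮j _ j<i  = sym (trans (cong₂ _+_ (upper-≮ i≮j) (upper-< j<i))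
                                       (trans (ℚ.+-identityˡ (adjℚ j i)) (cong (ℕtoℚ ∘ bool→ℕ) (Graph.sym H j i))))
    ... | tri≈ i≮i refl _ = trans (cong (ℕtoℚ ∘ bool→ℕ) (irrefl H i)) (sym (cong₂ _+_ (upper-≮ i≮i) (upper-≮ i≮i)))

  weightedResistance : (Fin N → Fin N → ℚ) → ℚ
  weightedResistance r = sumℚ N (λ i → sumℚ N (λ j → degreeℚ i * degreeℚ j * r i j))

  kemeny-weightedResistance : ∀ r → 1 ≤ numEdges H →
                              weightedResistance r ≡ ℕtoℚ 4 * ℕtoℚ (numEdges H) * kemeny H r
  kemeny-weightedResistance r m≥1 = begin
    weightedResistance r
      ≡⟨ ℕtoℚ-*-invℕ (4 ℕ.* m) (ℕ.≤-trans m≥1 (ℕ.m≤n*m m 4)) _ ⟨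
    ℕtoℚ (4 ℕ.* m) * (invℕ (4 ℕ.* m) * weightedResistance r)
      ≡⟨ cong (_* kemeny H r) (ℕtoℚ-* 4 m) ⟩
    ℕtoℚ 4 * ℕtoℚ m * kemeny H r ∎
    where
    m = numEdges H

module VertexSum {n N : ℕ} {k : Fin n → ℕ} {Gs : (l : Fin n) → Graph (k l)} {vs : (l : Fin n) → Fin (k l)}
                 {G : Graph N} {c : Fin N} {φ : (l : Fin n) → Fin (k l) → Fin N}
                 (S : IsVertexSum k Gs vs G c φ) where
  open IsVertexSum S

  -- x = c is the only vertex with more than one preimage (l, a).
  fiberSum : ((l : Fin n) → Fin (k l) → ℚ) → Fin N → ℚ
  fiberSum T x = sumℚ n (λ l → sumℚ (k l) (λ a → basis (φ l a) x * T l a))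

  fiberSum-cong : ∀ {T T′} → (∀ l a → T l a ≡ T′ l a) → ∀ x → fiberSum T x ≡ fiberSum T′ x
  fiberSum-cong T≗T′ x = sumℚ-cong n (λ l → sumℚ-cong (k l) (λ a → cong (basis (φ l a) x *_) (T≗T′ l a)))

  fiberSum-φ : ∀ T {l a} → a ≢ vs l → fiberSum T (φ l a) ≡ T l a
  fiberSum-φ T {l} {a} a≢v = begin
    fiberSum T (φ l a)
      ≡⟨ sumℚ-single n l other-components ⟩
    sumℚ (k l) (λ b → basis (φ l b) (φ l a) * T l b)
      ≡⟨ sumℚ-single (k l) a (λ b b≢a → basis-*-≢ (T l b) (b≢a ∘ inj l b a)) ⟩
    basis (φ l a) (φ l a) * T l a
      ≡⟨ basis-*-≡ (φ l a) (φ l a) (T l a) refl ⟩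
    T l a ∎
    where
    other-components : ∀ l′ → l′ ≢ l → sumℚ (k l′) (λ b → basis (φ l′ b) (φ l a) * T l′ b) ≡ 0ℚ
    other-components l′ l′≢l =
      sumℚ-zero (k l′) (λ b → basis-*-≢ (T l′ b) (a≢v ∘ disjoint l l′ a b (l′≢l ∘ sym) ∘ sym))

  sumℚ-fiberSum : ∀ T (F : Fin N → ℚ) →
                  sumℚ N (λ x → fiberSum T x * F x) ≡ sumℚ n (λ l → sumℚ (k l) (λ a → T l a * F (φ l a)))
  sumℚ-fiberSum T F = begin
    sumℚ N (λ x → fiberSum T x * F x)
      ≡⟨ sumℚ-cong N (λ x → trans (sumℚ-*ʳ n (F x) _) (sumℚ-cong n (λ l → trans (sumℚ-*ʳ (k l) (F x) _)
           (sumℚ-cong (k l) (λ a → ℚ.*-assoc (basis (φ l a) x) (T l a) (F x)))))) ⟩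
    sumℚ N (λ x → sumℚ n (λ l → sumℚ (k l) (λ a → basis (φ l a) x * (T l a * F x))))
      ≡⟨ sumℚ-comm N n _ ⟩
    sumℚ n (λ l → sumℚ N (λ x → sumℚ (k l) (λ a → basis (φ l a) x * (T l a * F x))))
      ≡⟨ sumℚ-cong n (λ l → sumℚ-comm N (k l) _) ⟩
    sumℚ n (λ l → sumℚ (k l) (λ a → sumℚ N (λ x → basis (φ l a) x * (T l a * F x))))
      ≡⟨ sumℚ-cong n (λ l → sumℚ-cong (k l) (λ a → sumℚ-basis (φ l a) (λ x → T l a * F x))) ⟩
    sumℚ n (λ l → sumℚ (k l) (λ a → T l a * F (φ l a))) ∎

  adjℚ-component : ∀ {l a b x y} → φ l a ≡ x → φ l b ≡ y → adjℚ (Gs l) a b ≡ adjℚ G x y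
  adjℚ-component {l} {a} {b} refl refl = cong (ℕtoℚ ∘ bool→ℕ) (sym (adjIn l a b))

  edge-component-unique : ∀ {x y l i a b a′ b′} → adj G x y ≡ true →
                          φ l a ≡ x → φ l b ≡ y → φ i a′ ≡ x → φ i b′ ≡ y → l ≡ i
  edge-component-unique {x} {y} {l} {i} {a} {b} {a′} {b′} xy ea eb ea′ eb′ with l ≟ i
  ... | yes l≡i = l≡i
  ... | no  l≢i = contradiction (trans (sym xy) (trans (cong (adj G x) (sym x≡y)) (irrefl G x))) λ ()
    where
    x≡y : x ≡ y
    x≡y = begin
      x            ≡⟨ ea ⟨
      φ l a        ≡⟨ cong (φ l) (disjoint l i a a′ l≢i (trans ea (sym ea′))) ⟩
      φ l (vs l)   ≡⟨ cong (φ l) (disjoint l i b b′ l≢i (trans eb (sym eb′))) ⟨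
      φ l b        ≡⟨ eb ⟩
      y            ∎

  adjℚ-fiberSum : ∀ x y → adjℚ G x y ≡ fiberSum (λ l b → sumℚ (k l) (λ a → basis (φ l a) x * adjℚ (Gs l) a b)) y
  adjℚ-fiberSum x y with adj G x y in xy
  ... | false = sym (sumℚ-zero n λ l → sumℚ-zero (k l) λ b → basis-*-zero (φ l b) y λ eb →
          sumℚ-zero (k l) λ a → basis-*-zero (φ l a) x λ ea →
            trans (adjℚ-component ea eb) (cong (ℕtoℚ ∘ bool→ℕ) xy))
  ... | true with i , a₀ , b₀ , ea₀ , eb₀ ← adjOnly x y xy = sym (begin
    fiberSum (λ l b → sumℚ (k l) (λ a → basis (φ l a) x * adjℚ (Gs l) a b)) y
      ≡⟨ sumℚ-single n i (λ l l≢i → sumℚ-zero (k l) λ b → basis-*-zero (φ l b) y λ eb →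
           sumℚ-zero (k l) λ a → basis-*-zero (φ l a) x λ ea →
             contradiction (edge-component-unique xy ea eb ea₀ eb₀) l≢i) ⟩
    sumℚ (k i) (λ b → basis (φ i b) y * sumℚ (k i) (λ a → basis (φ i a) x * adjℚ (Gs i) a b))
      ≡⟨ sumℚ-single (k i) b₀ (λ b b≢b₀ → basis-*-≢ _ λ eb → b≢b₀ (inj i b b₀ (trans eb (sym eb₀)))) ⟩
    basis (φ i b₀) y * sumℚ (k i) (λ a → basis (φ i a) x * adjℚ (Gs i) a b₀)
      ≡⟨ basis-*-≡ (φ i b₀) y _ eb₀ ⟩
    sumℚ (k i) (λ a → basis (φ i a) x * adjℚ (Gs i) a b₀)
      ≡⟨ sumℚ-single (k i) a₀ (λ a a≢a₀ → basis-*-≢ _ λ ea → a≢a₀ (inj i a a₀ (trans ea (sym ea₀)))) ⟩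
    basis (φ i a₀) x * adjℚ (Gs i) a₀ b₀
      ≡⟨ basis-*-≡ (φ i a₀) x _ ea₀ ⟩
    adjℚ (Gs i) a₀ b₀
      ≡⟨ trans (adjℚ-component ea₀ eb₀) (cong (ℕtoℚ ∘ bool→ℕ) xy) ⟩
    ℕtoℚ 1 ∎)

  neighbourSum-fiberSum : ∀ x (h : Fin N → ℚ) →
    sumℚ N (λ y → adjℚ G x y * h y) ≡ fiberSum (λ l a → sumℚ (k l) (λ b → adjℚ (Gs l) a b * h (φ l b))) x
  neighbourSum-fiberSum x h = begin
    sumℚ N (λ y → adjℚ G x y * h y)
      ≡⟨ sumℚ-cong N (λ y → cong (_* h y) (adjℚ-fiberSum x y)) ⟩
    sumℚ N (λ y → fiberSum (λ l b → sumℚ (k l) (λ a → basis (φ l a) x * adjℚ (Gs l) a b)) y * h y)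
      ≡⟨ sumℚ-fiberSum _ h ⟩
    sumℚ n (λ l → sumℚ (k l) (λ b → sumℚ (k l) (λ a → basis (φ l a) x * adjℚ (Gs l) a b) * h (φ l b)))
      ≡⟨ sumℚ-cong n (λ l → sumℚ-cong (k l) (λ b → trans (sumℚ-*ʳ (k l) (h (φ l b)) _)
           (sumℚ-cong (k l) (λ a → ℚ.*-assoc (basis (φ l a) x) (adjℚ (Gs l) a b) (h (φ l b)))))) ⟩
    sumℚ n (λ l → sumℚ (k l) (λ b → sumℚ (k l) (λ a → basis (φ l a) x * (adjℚ (Gs l) a b * h (φ l b)))))
      ≡⟨ sumℚ-cong n (λ l → sumℚ-comm (k l) (k l) _) ⟩
    sumℚ n (λ l → sumℚ (k l) (λ a → sumℚ (k l) (λ b → basis (φ l a) x * (adjℚ (Gs l) a b * h (φ l b)))))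
      ≡⟨ sumℚ-cong n (λ l → sumℚ-cong (k l) (λ a → sumℚ-*ˡ (k l) (basis (φ l a) x) _)) ⟨
    fiberSum (λ l a → sumℚ (k l) (λ b → adjℚ (Gs l) a b * h (φ l b))) x ∎

  degreeℚ-fiberSum : ∀ x → degreeℚ G x ≡ fiberSum (λ l → degreeℚ (Gs l)) x
  degreeℚ-fiberSum x = begin
    degreeℚ G x
      ≡⟨ degreeℚ-sum G x ⟩
    sumℚ N (adjℚ G x)
      ≡⟨ sumℚ-cong N (λ y → ℚ.*-identityʳ (adjℚ G x y)) ⟨
    sumℚ N (λ y → adjℚ G x y * 1ℚ)
      ≡⟨ neighbourSum-fiberSum x (λ _ → 1ℚ) ⟩
    fiberSum (λ l a → sumℚ (k l) (λ b → adjℚ (Gs l) a b * 1ℚ)) x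
      ≡⟨ fiberSum-cong (λ l a → trans (sumℚ-cong (k l) (λ b → ℚ.*-identityʳ _)) (sym (degreeℚ-sum (Gs l) a))) x ⟩
    fiberSum (λ l → degreeℚ (Gs l)) x ∎

  sumℚ-degreeℚ : ∀ (F : Fin N → ℚ) →
                 sumℚ N (λ x → degreeℚ G x * F x) ≡ sumℚ n (λ l → sumℚ (k l) (λ a → degreeℚ (Gs l) a * F (φ l a)))
  sumℚ-degreeℚ F = trans (sumℚ-cong N (λ x → cong (_* F x) (degreeℚ-fiberSum x))) (sumℚ-fiberSum _ F)

  numEdges-vertexSum : numEdges G ≡ sumℕ n (λ l → numEdges (Gs l))
  numEdges-vertexSum = ℕ.*-cancelˡ-≡ _ _ 2 (ℕtoℚ-injective (begin
    ℕtoℚ (2 ℕ.* numEdges G)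
      ≡⟨ ℕtoℚ-* 2 (numEdges G) ⟩
    ℕtoℚ 2 * ℕtoℚ (numEdges G)
      ≡⟨ handshake G ⟨
    sumℚ N (degreeℚ G)
      ≡⟨ sumℚ-cong N (λ x → ℚ.*-identityʳ (degreeℚ G x)) ⟨
    sumℚ N (λ x → degreeℚ G x * 1ℚ)
      ≡⟨ sumℚ-degreeℚ (λ _ → 1ℚ) ⟩
    sumℚ n (λ l → sumℚ (k l) (λ a → degreeℚ (Gs l) a * 1ℚ))
      ≡⟨ sumℚ-cong n (λ l → trans (sumℚ-cong (k l) (λ a → ℚ.*-identityʳ _)) (handshake (Gs l))) ⟩
    sumℚ n (λ l → ℕtoℚ 2 * ℕtoℚ (numEdges (Gs l)))
      ≡⟨ sumℚ-*ˡ n (ℕtoℚ 2) _ ⟨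
    ℕtoℚ 2 * sumℚ n (λ l → ℕtoℚ (numEdges (Gs l)))
      ≡⟨ cong (ℕtoℚ 2 *_) (sumℕ-ℕtoℚ n _) ⟨
    ℕtoℚ 2 * ℕtoℚ (sumℕ n (λ l → numEdges (Gs l)))
      ≡⟨ ℕtoℚ-* 2 (sumℕ n (λ l → numEdges (Gs l))) ⟨
    ℕtoℚ (2 ℕ.* sumℕ n (λ l → numEdges (Gs l))) ∎))

  blockSum : (Fin N → Fin N → ℚ) → (l l′ : Fin n) → ℚ
  blockSum F l l′ =
    sumℚ (k l) (λ a → sumℚ (k l′) (λ b → degreeℚ (Gs l) a * degreeℚ (Gs l′) b * F (φ l a) (φ l′ b)))

  sumℚ²-degreeℚ : ∀ (F : Fin N → Fin N → ℚ) →
                  sumℚ N (λ x → sumℚ N (λ y → degreeℚ G x * degreeℚ G y * F x y))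
                  ≡ sumℚ n (λ l → sumℚ n (blockSum F l))
  sumℚ²-degreeℚ F = begin
    sumℚ N (λ x → sumℚ N (λ y → degreeℚ G x * degreeℚ G y * F x y))
      ≡⟨ sumℚ-cong N (λ x → factor (degreeℚ G x) (degreeℚ G) (F x)) ⟩
    sumℚ N (λ x → degreeℚ G x * sumℚ N (λ y → degreeℚ G y * F x y))
      ≡⟨ sumℚ-degreeℚ _ ⟩
    sumℚ n (λ l → sumℚ (k l) (λ a → d l a * sumℚ N (λ y → degreeℚ G y * F (φ l a) y)))
      ≡⟨ sumℚ-cong n (λ l → sumℚ-cong (k l) (λ a → cong (d l a *_) (sumℚ-degreeℚ _))) ⟩
    sumℚ n (λ l → sumℚ (k l) (λ a → d l a * sumℚ n (λ l′ → sumℚ (k l′) (λ b → d l′ b * F (φ l a) (φ l′ b)))))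
      ≡⟨ sumℚ-cong n (λ l → sumℚ-cong (k l) (λ a → trans (sumℚ-*ˡ n (d l a) _)
           (sumℚ-cong n (λ l′ → sym (factor (d l a) (d l′) (λ b → F (φ l a) (φ l′ b))))))) ⟩
    sumℚ n (λ l → sumℚ (k l) (λ a → sumℚ n (λ l′ → sumℚ (k l′) (λ b → d l a * d l′ b * F (φ l a) (φ l′ b)))))
      ≡⟨ sumℚ-cong n (λ l → sumℚ-comm (k l) n _) ⟩
    sumℚ n (λ l → sumℚ n (blockSum F l)) ∎
    where
    d : (l : Fin n) → Fin (k l) → ℚ
    d l = degreeℚ (Gs l)

    factor : ∀ {K} u (v w : Fin K → ℚ) → sumℚ K (λ b → u * v b * w b) ≡ u * sumℚ K (λ b → v b * w b)
    factor {K} u v w = trans (sumℚ-cong K (λ b → ℚ.*-assoc u (v b) (w b))) (sym (sumℚ-*ˡ K u _))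

  laplacian-φ : ∀ {l a} (x : Fin N → ℚ) → a ≢ vs l → laplacian G x (φ l a) ≡ laplacian (Gs l) (x ∘ φ l) a
  laplacian-φ {l} {a} x a≢v = begin
    laplacian G x (φ l a)
      ≡⟨ laplacian-adjℚ G x (φ l a) ⟩
    degreeℚ G (φ l a) * x (φ l a) - sumℚ N (λ y → adjℚ G (φ l a) y * x y)
      ≡⟨ cong₂ (λ d s → d * x (φ l a) - s) (trans (degreeℚ-fiberSum (φ l a)) (fiberSum-φ _ a≢v))
                                           (trans (neighbourSum-fiberSum (φ l a) x) (fiberSum-φ _ a≢v)) ⟩
    degreeℚ (Gs l) a * x (φ l a) - sumℚ (k l) (λ b → adjℚ (Gs l) a b * x (φ l b))
      ≡⟨ laplacian-adjℚ (Gs l) (x ∘ φ l) a ⟨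
    laplacian (Gs l) (x ∘ φ l) a ∎

  laplacian-restrict : ∀ l (x : Fin N → ℚ) (h : Fin (k l) → ℚ) →
                       (∀ a → a ≢ vs l → laplacian G x (φ l a) ≡ h a) → sumℚ (k l) h ≡ 0ℚ →
                       ∀ a → laplacian (Gs l) (x ∘ φ l) a ≡ h a
  laplacian-restrict l x h Lx≗h Σh≡0 a with a ≟ vs l
  ... | no  a≢v  = trans (sym (laplacian-φ x a≢v)) (Lx≗h a a≢v)
  ... | yes refl = sumℚ-agree (k l) (vs l) (λ b b≢v → trans (sym (laplacian-φ x b≢v)) (Lx≗h b b≢v))
                     (trans (sumℚ-laplacian (Gs l) (x ∘ φ l)) (sym Σh≡0))

  basis-φ : ∀ l a b → basis (φ l a) (φ l b) ≡ basis a b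
  basis-φ l a b with a ≟ b
  ... | yes refl = basis-refl (φ l a)
  ... | no  a≢b  = basis-≢ (a≢b ∘ inj l a b)

  basis-across : ∀ {l l′ a b} → l ≢ l′ → a ≢ vs l → basis (φ l′ b) (φ l a) ≡ 0ℚ
  basis-across {l} {l′} {a} {b} l≢l′ a≢v = basis-≢ (λ e → a≢v (disjoint l l′ a b l≢l′ (sym e)))

  twiceEdges : Fin n → ℚ
  twiceEdges l = ℕtoℚ 2 * ℕtoℚ (numEdges (Gs l))

  module _ {rs : (l : Fin n) → Fin (k l) → Fin (k l) → ℚ} (Rs : ∀ l → IsEffRes (Gs l) (rs l)) where

    effRes-restrict : ∀ l {x : Fin N → ℚ} {a₁ a₂} →
                      (∀ a → a ≢ vs l → laplacian G x (φ l a) ≡ basis a₁ a - basis a₂ a) →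
                      rs l a₁ a₂ ≡ x (φ l a₁) - x (φ l a₂)
    effRes-restrict l {x} {a₁} {a₂} Lx = effRes-unique (Gs l) (Rs l)
      (laplacian-restrict l x (λ a → basis a₁ a - basis a₂ a) Lx (begin
        sumℚ (k l) (λ a → basis a₁ a - basis a₂ a)          ≡⟨ sumℚ-cong (k l) (λ a → ℚ.*-identityʳ _) ⟨
        sumℚ (k l) (λ a → (basis a₁ a - basis a₂ a) * 1ℚ)   ≡⟨ sumℚ-basis-difference a₁ a₂ (λ _ → 1ℚ) ⟩
        1ℚ - 1ℚ                                              ≡⟨⟩
        0ℚ                                                   ∎))

    moment-vs : Fin n → ℚ
    moment-vs l = moment (Gs l) (rs l) (vs l)

    module _ {r : Fin N → Fin N → ℚ} (R : IsEffRes G r) where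

      effRes-within : ∀ l a b → r (φ l a) (φ l b) ≡ rs l a b
      effRes-within l a b with x , Lx , r≡ ← R (φ l a) (φ l b) = trans r≡ (sym (effRes-restrict l λ a′ _ →
        trans (Lx (φ l a′)) (cong₂ _-_ (basis-φ l a a′) (basis-φ l b a′))))

      effRes-across : ∀ {l l′} a b → l ≢ l′ → r (φ l a) (φ l′ b) ≡ rs l a (vs l) + rs l′ (vs l′) b
      effRes-across {l} {l′} a b l≢l′ with x , Lx , r≡ ← R (φ l a) (φ l′ b) = begin
        r (φ l a) (φ l′ b)
          ≡⟨ r≡ ⟩
        x (φ l a) - x (φ l′ b)
          ≡⟨ solve 3 (λ p m q → p :- q := (p :- m) :+ (m :- q)) refl (x (φ l a)) (x c) (x (φ l′ b)) ⟩
        (x (φ l a) - x c) + (x c - x (φ l′ b))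
          ≡⟨ cong₂ (λ u v → (x (φ l a) - x u) + (x v - x (φ l′ b))) (glue l) (glue l′) ⟨
        (x (φ l a) - x (φ l (vs l))) + (x (φ l′ (vs l′)) - x (φ l′ b))
          ≡⟨ cong₂ _+_ (effRes-restrict l inˡ) (effRes-restrict l′ inˡ′) ⟨
        rs l a (vs l) + rs l′ (vs l′) b ∎
        where
        inˡ : ∀ a′ → a′ ≢ vs l → laplacian G x (φ l a′) ≡ basis a a′ - basis (vs l) a′
        inˡ a′ a′≢v = trans (Lx (φ l a′))
          (cong₂ _-_ (basis-φ l a a′) (trans (basis-across l≢l′ a′≢v) (sym (basis-≢ (a′≢v ∘ sym)))))

        inˡ′ : ∀ b′ → b′ ≢ vs l′ → laplacian G x (φ l′ b′) ≡ basis (vs l′) b′ - basis b b′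
        inˡ′ b′ b′≢v = trans (Lx (φ l′ b′))
          (cong₂ _-_ (trans (basis-across (l≢l′ ∘ sym) b′≢v) (sym (basis-≢ (b′≢v ∘ sym)))) (basis-φ l′ b b′))

      blockSum-diagonal : ∀ l → blockSum r l l ≡ weightedResistance (Gs l) (rs l)
      blockSum-diagonal l = sumℚ-cong (k l) (λ a → sumℚ-cong (k l) (λ b →
        cong (degreeℚ (Gs l) a * degreeℚ (Gs l) b *_) (effRes-within l a b)))

      blockSum-offDiagonal : ∀ {l l′} → l′ ≢ l →
                             blockSum r l l′ ≡ moment-vs l * twiceEdges l′ + twiceEdges l * moment-vs l′
      blockSum-offDiagonal {l} {l′} l′≢l = begin
        blockSum r l l′
          ≡⟨ sumℚ-cong (k l) (λ a → sumℚ-cong (k l′) (λ b →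
               cong (d l a * d l′ b *_) (effRes-across a b (l′≢l ∘ sym)))) ⟩
        sumℚ (k l) (λ a → sumℚ (k l′) (λ b → d l a * d l′ b * (rs l a (vs l) + rs l′ (vs l′) b)))
          ≡⟨ sumℚ-separable (k l) (k l′) (d l) (λ a → rs l a (vs l)) (d l′) (rs l′ (vs l′)) ⟩
        moment-vs l * sumℚ (k l′) (d l′) + sumℚ (k l) (d l) * sumℚ (k l′) (λ b → d l′ b * rs l′ (vs l′) b)
          ≡⟨ cong₂ _+_ (cong (moment-vs l *_) (handshake (Gs l′))) (cong₂ _*_ (handshake (Gs l))
               (sumℚ-cong (k l′) (λ b → cong (d l′ b *_) (effRes-sym (Gs l′) (Rs l′) b (vs l′))))) ⟩
        moment-vs l * twiceEdges l′ + twiceEdges l * moment-vs l′ ∎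
        where
        d : (l : Fin n) → Fin (k l) → ℚ
        d l = degreeℚ (Gs l)

      weightedResistance-vertexSum : (∀ l → 1 ≤ numEdges (Gs l)) →
        weightedResistance G r
        ≡ ℕtoℚ 4 * sumℚ n (λ l → ℕtoℚ (numEdges (Gs l)) * (kemeny (Gs l) (rs l) + sumExcept n l moment-vs))
      weightedResistance-vertexSum m≥1 = begin
        weightedResistance G r
          ≡⟨ sumℚ²-degreeℚ r ⟩
        sumℚ n (λ l → sumℚ n (blockSum r l))
          ≡⟨ sumℚ-cong n (λ l → sumExcept-split l (blockSum r l)) ⟩
        sumℚ n (λ l → blockSum r l l + sumExcept n l (blockSum r l))
          ≡⟨ sumℚ-cong n (λ l → cong₂ _+_ (blockSum-diagonal l) (sumExcept-cong l (λ _ → blockSum-offDiagonal))) ⟩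
        sumℚ n (λ l → weightedResistance (Gs l) (rs l) + sumExcept n l (offDiagonal l))
          ≡⟨ sumℚ-+ n _ _ ⟩
        sumℚ n (λ l → weightedResistance (Gs l) (rs l)) + sumℚ n (λ l → sumExcept n l (offDiagonal l))
          ≡⟨ cong₂ _+_ (sumℚ-cong n (λ l → kemeny-weightedResistance (Gs l) (rs l) (m≥1 l)))
                       (sumℚ-sumExcept-symmetric moment-vs twiceEdges) ⟩
        sumℚ n (λ l → ℕtoℚ 4 * m l * K l) + ℕtoℚ 2 * sumℚ n (λ l → twiceEdges l * B l)
          ≡⟨ cong (sumℚ n (λ l → ℕtoℚ 4 * m l * K l) +_) (sumℚ-*ˡ n (ℕtoℚ 2) _) ⟩
        sumℚ n (λ l → ℕtoℚ 4 * m l * K l) + sumℚ n (λ l → ℕtoℚ 2 * (twiceEdges l * B l))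
          ≡⟨ sumℚ-+ n _ _ ⟨
        sumℚ n (λ l → ℕtoℚ 4 * m l * K l + ℕtoℚ 2 * (twiceEdges l * B l))
          ≡⟨ sumℚ-cong n (λ l → solve 3 (λ m K B →
                 con (ℕtoℚ 4) :* m :* K :+ con (ℕtoℚ 2) :* (con (ℕtoℚ 2) :* m :* B)
                 := con (ℕtoℚ 4) :* (m :* (K :+ B)))
               refl (m l) (K l) (B l)) ⟩
        sumℚ n (λ l → ℕtoℚ 4 * (m l * (K l + B l)))
          ≡⟨ sumℚ-*ˡ n (ℕtoℚ 4) _ ⟨
        ℕtoℚ 4 * sumℚ n (λ l → m l * (K l + B l)) ∎
        where
        m K B : Fin n → ℚ
        m l = ℕtoℚ (numEdges (Gs l))
        K l = kemeny (Gs l) (rs l)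
        B l = sumExcept n l moment-vs

        offDiagonal : Fin n → Fin n → ℚ
        offDiagonal l l′ = moment-vs l * twiceEdges l′ + twiceEdges l * moment-vs l′

open VertexSum using (numEdges-vertexSum; weightedResistance-vertexSum)

corollary2p4 : (n : ℕ) → 1 ≤ n →
    (k : Fin n → ℕ) (Gs : (i : Fin n) → Graph (k i)) (vs : (i : Fin n) → Fin (k i)) →
    (∀ i → Connected (Gs i)) → (∀ i → 1 ≤ numEdges (Gs i)) →
    (N : ℕ) (G : Graph N) (c : Fin N) (φ : (i : Fin n) → Fin (k i) → Fin N) →
    IsVertexSum k Gs vs G c φ →
    (rs : (i : Fin n) → Fin (k i) → Fin (k i) → ℚ) → (∀ i → IsEffRes (Gs i) (rs i)) →
    (r : Fin N → Fin N → ℚ) → IsEffRes G r →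
    kemeny G r ≡
      sumℚ n (λ i → ℕtoℚ (numEdges (Gs i)) *
        (kemeny (Gs i) (rs i) +
          sumℚ n (λ j → if ⌊ j ≟ i ⌋ then 0ℚ else moment (Gs j) (rs j) (vs j))))
      * invℕ (sumℕ n (λ i → numEdges (Gs i)))
corollary2p4 n _ k Gs vs _ m≥1 N G c φ S rs Rs r R = begin
  invℕ (4 ℕ.* numEdges G) * weightedResistance G r
    ≡⟨ cong (λ m → invℕ (4 ℕ.* m) * weightedResistance G r) (numEdges-vertexSum S) ⟩
  invℕ (4 ℕ.* M) * weightedResistance G r
    ≡⟨ cong (invℕ (4 ℕ.* M) *_) (weightedResistance-vertexSum S Rs R m≥1) ⟩
  invℕ (4 ℕ.* M) * (ℕtoℚ 4 * X)
    ≡⟨ invℕ-*-ℕtoℚ 3 M X ⟩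
  X * invℕ M ∎
  where
  M : ℕ
  M = sumℕ n (λ i → numEdges (Gs i))

  X : ℚ
  X = sumℚ n (λ i → ℕtoℚ (numEdges (Gs i)) *
        (kemeny (Gs i) (rs i) + sumExcept n i (λ j → moment (Gs j) (rs j) (vs j))))
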